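{- Let $G$ be a finite simple graph with vertex set $V(G)=\{v_1,v_2,\dots,v_n\}$ ordered so that $d(v_1)\leq d(v_2)\leq\cdots\leq d(v_n)$, and let $k$ be a natural number. Then $$\alpha^{(k)}(G)=\max\{s\mid D_k(\{v_1,\dots,v_s\})\leq n-s\}=\max\{s\mid \{v_1,\dots,v_s\}\text{ is a }\delta_k\text{ -small set of }G\}.$$
   Context: $d(v)$ is the degree of $v$. For nonempty $W\subseteq V(G)$, $D_k(W)=\left(\frac{1}{|W|}\sum_{v\in W}d^k(v)\right)^{1/k}$. $W$ is a $\delta_k$-small set if $D_k(W)\leq n-|W|$. $\alpha^{(k)}(G)$ is the maximum number of vertices of a $\delta_k$-small set of $G$. -}

module Defs where

open import Data.Nat using (ℕ; zero; suc; _+_; _*_; _∸_; _^_; _≤_; _<ᵇ_)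
open import Data.Bool using (Bool; true; false; if_then_else_)
open import Data.Fin using (Fin; toℕ)
import Data.Fin as Fin
open import Data.Fin.Subset using (Subset; ∣_∣; Nonempty)
open import Data.Vec using (lookup; tabulate)
open import Data.Product using (Σ; ∃; _×_)
open import Relation.Binary.PropositionalEquality using (_≡_)
open import Function.Bundles using (_↔_; Inverse)

record Graph (n : ℕ) : Set where
  field
    adj    : Fin n → Fin n → Bool
    sym    : ∀ u v → adj u v ≡ adj v u
    irrefl : ∀ v → adj v v ≡ false

sumFin : (n : ℕ) → (Fin n → ℕ) → ℕ
sumFin zero    f = 0
sumFin (suc n) f = f Fin.zero + sumFin n (λ i → f (Fin.suc i))

deg : ∀ {n} → Graph n → Fin n → ℕ
deg {n} G v = sumFin n (λ w → if Graph.adj G v w then 1 else 0)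

powSum : ∀ {n} → Graph n → ℕ → Subset n → ℕ
powSum {n} G k W = sumFin n (λ v → if lookup W v then deg G v ^ k else 0)

-- "D_k(W) ≤ m" for nonempty W and k ≥ 1, stated without reals:
-- D_k(W) = ((1/|W|) Σ_{v∈W} d(v)^k)^{1/k} ≤ m  iff  Σ_{v∈W} d(v)^k ≤ |W| · m^k
-- (both sides ≥ 0, x ↦ x^k strictly monotone on [0,∞) for k ≥ 1, |W| > 0).
DkLe : ∀ {n} → Graph n → ℕ → Subset n → ℕ → Set
DkLe G k W m = powSum G k W ≤ ∣ W ∣ * (m ^ k)

IsSmall : ∀ {n} → Graph n → ℕ → Subset n → Set
IsSmall {n} G k W = Nonempty W × DkLe G k W (n ∸ ∣ W ∣)

SmallSize : ∀ {n} → Graph n → ℕ → ℕ → Set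
SmallSize {n} G k t = Σ (Subset n) λ W → ∣ W ∣ ≡ t × IsSmall G k W

IsMax : (ℕ → Set) → ℕ → Set
IsMax P s = P s × (∀ t → P t → t ≤ s)

-- Given the listing v_1,…,v_n as a bijection σ : Fin n ↔ Fin n (v_{i+1} = σ i),
-- prefix σ s = {v_1,…,v_s} = {σ i | toℕ i < s}.
prefix : ∀ {n} → Fin n ↔ Fin n → ℕ → Subset n
prefix σ s = tabulate (λ v → toℕ (Inverse.from σ v) <ᵇ s)

{-# OPTIONS --safe #-}
module Submission where

-- Sorting the vertices by degree, the k-th power sum of the degrees over any
-- s-set W is at least the power sum over the prefix {v_1,…,v_s}: take the
-- indicator of W in the sorted order and slide its selected indices to the
-- front, which cannot increase the sum as the sorted powers are nondecreasing.  Hence W is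
-- δ_k-small only if the prefix of the same size is, so all three maxima are
-- that of the prefix condition; it exists since {v_1} is always small, as
-- every degree is at most n - 1.

open import Defs
open import Data.Nat using (ℕ; zero; suc; _+_; _*_; _^_; _≤_; _<_; _∸_; _<ᵇ_; z≤n; s≤s; s≤s⁻¹; _≤?_)
open import Data.Nat.Properties
open import Data.Bool using (Bool; true; false; if_then_else_)
open import Data.Fin using (Fin; toℕ) renaming (zero to fzero; suc to fsuc)
import Data.Fin as Fin
open import Data.Fin.Subset using (Subset; ∣_∣; Nonempty)
open import Data.Fin.Subset.Properties using (∣p∣≤n; x∈p⇒∣p-x∣<∣p∣)
open import Data.Vec using ([]; _∷_; lookup)
open import Data.Vec.Properties using (lookup∘tabulate; lookup⇒[]=)
open import Data.Product using (∃; _×_; _,_)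
open import Function using (_∘_)
open import Function.Bundles using (_↔_; Inverse; _⇔_; mk⇔; Equivalence)
open import Relation.Binary.Core using (_Preserves_⟶_)
open import Relation.Binary.PropositionalEquality using (_≡_; refl; sym; trans; cong; cong₂; subst)
open import Relation.Nullary using (yes; no)
open import Relation.Nullary.Decidable using (_×-dec_)
open import Relation.Unary using (Decidable)
import Algebra.Properties.CommutativeMonoid.Sum as Sum

open Sum +-0-commutativeMonoid using (sum; sum-permute)

sumFin-cong : ∀ n {f g : Fin n → ℕ} → (∀ i → f i ≡ g i) → sumFin n f ≡ sumFin n g
sumFin-cong zero    f≗g = refl
sumFin-cong (suc n) f≗g = cong₂ _+_ (f≗g fzero) (sumFin-cong n (f≗g ∘ fsuc))

sumFin-zero : ∀ n → sumFin n (λ _ → 0) ≡ 0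
sumFin-zero zero    = refl
sumFin-zero (suc n) = sumFin-zero n

sumFin≡sum : ∀ n (f : Fin n → ℕ) → sumFin n f ≡ sum f
sumFin≡sum zero    f = refl
sumFin≡sum (suc n) f = cong (f fzero +_) (sumFin≡sum n (f ∘ fsuc))

sumFin-permute : ∀ n (f : Fin n → ℕ) (σ : Fin n ↔ Fin n) →
  sumFin n f ≡ sumFin n (f ∘ Inverse.to σ)
sumFin-permute n f σ =
  trans (sumFin≡sum n f) (trans (sum-permute f σ) (sym (sumFin≡sum n _)))

sumOver : ∀ {n} → (Fin n → Bool) → (Fin n → ℕ) → ℕ
sumOver {n} b f = sumFin n (λ i → if b i then f i else 0)

count : ∀ {n} → (Fin n → Bool) → ℕ
count b = sumOver b (λ _ → 1)

initial : ∀ {n} → ℕ → Fin n → Bool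
initial s i = toℕ i <ᵇ s

∣p∣≡count : ∀ {n} (p : Subset n) → ∣ p ∣ ≡ count (lookup p)
∣p∣≡count []          = refl
∣p∣≡count (true ∷ p)  = cong suc (∣p∣≡count p)
∣p∣≡count (false ∷ p) = ∣p∣≡count p

count≤n : ∀ {n} (b : Fin n → Bool) → count b ≤ n
count≤n {zero}  b = z≤n
count≤n {suc n} b with b fzero
... | true  = s≤s (count≤n (b ∘ fsuc))
... | false = m≤n⇒m≤1+n (count≤n (b ∘ fsuc))

count<n : ∀ {n} (b : Fin n → Bool) {v} → b v ≡ false → count b < n
count<n {suc n} b {fzero}  bv≡false rewrite bv≡false = s≤s (count≤n (b ∘ fsuc))
count<n {suc n} b {fsuc v} bv≡false with b fzero
... | true  = s≤s (count<n (b ∘ fsuc) bv≡false)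
... | false = m<n⇒m<1+n (count<n (b ∘ fsuc) bv≡false)

count-initial : ∀ {n s} → s ≤ n → count (initial {n} s) ≡ s
count-initial {n}     {zero}  _         = sumFin-zero n
count-initial {suc n} {suc s} (s≤s s≤n) = cong suc (count-initial s≤n)

sumOver≤count* : ∀ {n} (b : Fin n → Bool) (f : Fin n → ℕ) {M} →
  (∀ i → f i ≤ M) → sumOver b f ≤ count b * M
sumOver≤count* {zero}  b f f≤M = z≤n
sumOver≤count* {suc n} b f f≤M with b fzero
... | true  = +-mono-≤ (f≤M fzero) (sumOver≤count* (b ∘ fsuc) (f ∘ fsuc) (f≤M ∘ fsuc))
... | false = sumOver≤count* (b ∘ fsuc) (f ∘ fsuc) (f≤M ∘ fsuc)

sumOver-initial-≤-shift : ∀ {m t} (g : Fin (suc m) → ℕ) → g Preserves Fin._≤_ ⟶ _≤_ →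
  t ≤ m → sumOver (initial t) g ≤ sumOver (initial t) (g ∘ fsuc)
sumOver-initial-≤-shift {m} {zero} g g-mono _ = ≤-trans (≤-reflexive (sumFin-zero (suc m))) z≤n
sumOver-initial-≤-shift {suc m} {suc t} g g-mono (s≤s t≤m) =
  +-mono-≤ (g-mono z≤n) (sumOver-initial-≤-shift (g ∘ fsuc) (λ i≤j → g-mono (s≤s i≤j)) t≤m)

-- If b skips the first index, every selected index is moved one step left.
sumOver-initial-count≤ : ∀ {n} (b : Fin n → Bool) (g : Fin n → ℕ) →
  g Preserves Fin._≤_ ⟶ _≤_ → sumOver (initial (count b)) g ≤ sumOver b g
sumOver-initial-count≤ {zero}  b g g-mono = z≤n
sumOver-initial-count≤ {suc n} b g g-mono
  with b fzero | sumOver-initial-count≤ (b ∘ fsuc) (g ∘ fsuc) (λ i≤j → g-mono (s≤s i≤j))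
... | true  | rest = +-monoʳ-≤ (g fzero) rest
... | false | rest = ≤-trans (sumOver-initial-≤-shift g g-mono (count≤n (b ∘ fsuc))) rest

nonempty⇒1≤∣p∣ : ∀ {n} {p : Subset n} → Nonempty p → 1 ≤ ∣ p ∣
nonempty⇒1≤∣p∣ (_ , x∈p) = ≤-trans (s≤s z≤n) (x∈p⇒∣p-x∣<∣p∣ x∈p)

module _ {n} (σ : Fin n ↔ Fin n) where
  open Inverse σ using (to; strictlyInverseʳ)

  lookup-prefix : ∀ s i → lookup (prefix σ s) (to i) ≡ initial s i
  lookup-prefix s i =
    trans (lookup∘tabulate _ (to i)) (cong (λ j → toℕ j <ᵇ s) (strictlyInverseʳ i))

  sumOver-prefix : ∀ s (f : Fin n → ℕ) → sumOver (lookup (prefix σ s)) f ≡ sumOver (initial s) (f ∘ to)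
  sumOver-prefix s f = trans (sumFin-permute n _ σ)
    (sumFin-cong n (λ i → cong (λ c → if c then f (to i) else 0) (lookup-prefix s i)))

  ∣prefix∣ : ∀ {s} → s ≤ n → ∣ prefix σ s ∣ ≡ s
  ∣prefix∣ {s} s≤n =
    trans (∣p∣≡count (prefix σ s)) (trans (sumOver-prefix s (λ _ → 1)) (count-initial s≤n))

  sumOver-prefix-minimal : (f : Fin n → ℕ) → (f ∘ to) Preserves Fin._≤_ ⟶ _≤_ → (W : Subset n) →
    sumOver (lookup (prefix σ ∣ W ∣)) f ≤ sumOver (lookup W) f
  sumOver-prefix-minimal f f∘to-mono W = begin
    sumOver (lookup (prefix σ ∣ W ∣)) f                ≡⟨ sumOver-prefix ∣ W ∣ f ⟩
    sumOver (initial ∣ W ∣) (f ∘ to)                   ≡⟨ cong (λ c → sumOver (initial c) (f ∘ to)) ∣W∣≡ ⟩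
    sumOver (initial (count (lookup W ∘ to))) (f ∘ to) ≤⟨ sumOver-initial-count≤ (lookup W ∘ to) (f ∘ to) f∘to-mono ⟩
    sumOver (lookup W ∘ to) (f ∘ to)                   ≡⟨ sym (sumFin-permute n _ σ) ⟩
    sumOver (lookup W) f                               ∎
    where
    open ≤-Reasoning
    ∣W∣≡ : ∣ W ∣ ≡ count (lookup W ∘ to)
    ∣W∣≡ = trans (∣p∣≡count W) (sumFin-permute n _ σ)

prefix-nonempty : ∀ {n s} (σ : Fin n ↔ Fin n) → 1 ≤ s → s ≤ n → Nonempty (prefix σ s)
prefix-nonempty {zero}  σ (s≤s _) ()
prefix-nonempty {suc n} {suc s} σ _ _ =
  Inverse.to σ fzero , lookup⇒[]= _ (prefix σ (suc s)) (lookup-prefix σ (suc s) fzero)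

greatest-≤ : ∀ {P : ℕ → Set} → Decidable P → ∀ {b} m → b ≤ m → P b →
  ∃ (IsMax (λ s → s ≤ m × P s))
greatest-≤ P? zero z≤n Pb = zero , (z≤n , Pb) , λ _ (t≤0 , _) → t≤0
greatest-≤ {P} P? (suc m) b≤1+m Pb with P? (suc m)
... | yes P1+m = suc m , (≤-refl , P1+m) , λ _ (t≤1+m , _) → t≤1+m
... | no ¬P1+m = extend (greatest-≤ P? m (below b≤1+m Pb) Pb)
  where
  below : ∀ {t} → t ≤ suc m → P t → t ≤ m
  below t≤1+m Pt = s≤s⁻¹ (≤∧≢⇒< t≤1+m λ { refl → ¬P1+m Pt })
  extend : ∃ (IsMax (λ s → s ≤ m × P s)) → ∃ (IsMax (λ s → s ≤ suc m × P s))
  extend (α , (α≤m , Pα) , maximal) =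
    α , (m≤n⇒m≤1+n α≤m , Pα) , λ t (t≤1+m , Pt) → maximal t (below t≤1+m Pt , Pt)

IsMax-cong : ∀ {P Q : ℕ → Set} → (∀ s → P s ⇔ Q s) → ∀ {α} → IsMax P α → IsMax Q α
IsMax-cong P⇔Q (Pα , maximal) =
  Equivalence.to (P⇔Q _) Pα , λ t Qt → maximal t (Equivalence.from (P⇔Q t) Qt)

deg≤n∸1 : ∀ {n} (G : Graph n) v → deg G v ≤ n ∸ 1
deg≤n∸1 {suc n} G v = s≤s⁻¹ (count<n (Graph.adj G v) (Graph.irrefl G v))

DkLe-n∸1 : ∀ {n} (G : Graph n) k (W : Subset n) → DkLe G k W (n ∸ 1)
DkLe-n∸1 {n} G k W = subst (λ c → powSum G k W ≤ c * (n ∸ 1) ^ k) (sym (∣p∣≡count W))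
  (sumOver≤count* (lookup W) _ (λ v → ^-monoˡ-≤ k (deg≤n∸1 G v)))

module _ {n} (G : Graph n) (σ : Fin n ↔ Fin n) (k : ℕ) where
  open Inverse σ using (to)

  PrefixSmall : ℕ → Set
  PrefixSmall s = 1 ≤ s × s ≤ n × DkLe G k (prefix σ s) (n ∸ s)

  prefixSmall-greatest : 1 ≤ n → ∃ (IsMax PrefixSmall)
  prefixSmall-greatest 1≤n =
    let α , isMax = greatest-≤ P? n 1≤n (≤-refl , DkLe-n∸1 G k (prefix σ 1))
    in  α , IsMax-cong reorder isMax
    where
    P? : Decidable (λ s → 1 ≤ s × DkLe G k (prefix σ s) (n ∸ s))
    P? s = 1 ≤? s ×-dec _ ≤? _
    reorder : ∀ s → (s ≤ n × 1 ≤ s × DkLe G k (prefix σ s) (n ∸ s)) ⇔ PrefixSmall s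
    reorder s = mk⇔ (λ (s≤n , 1≤s , D) → 1≤s , s≤n , D) (λ (1≤s , s≤n , D) → s≤n , 1≤s , D)

  DkLe-prefix⇔ : ∀ {s} → s ≤ n → DkLe G k (prefix σ s) (n ∸ s) ⇔ DkLe G k (prefix σ s) (n ∸ ∣ prefix σ s ∣)
  DkLe-prefix⇔ {s} s≤n = mk⇔ (subst D (sym (∣prefix∣ σ s≤n))) (subst D (∣prefix∣ σ s≤n))
    where
    D : ℕ → Set
    D c = DkLe G k (prefix σ s) (n ∸ c)

  prefixSmall⇒isSmall : ∀ {s} → PrefixSmall s → IsSmall G k (prefix σ s)
  prefixSmall⇒isSmall (1≤s , s≤n , D) = prefix-nonempty σ 1≤s s≤n , Equivalence.to (DkLe-prefix⇔ s≤n) D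

  prefixSmall⇔isSmall : ∀ s → PrefixSmall s ⇔ (1 ≤ s × s ≤ n × IsSmall G k (prefix σ s))
  prefixSmall⇔isSmall s = mk⇔
    (λ P@(1≤s , s≤n , _) → 1≤s , s≤n , prefixSmall⇒isSmall P)
    (λ (1≤s , s≤n , _ , D) → 1≤s , s≤n , Equivalence.from (DkLe-prefix⇔ s≤n) D)

  prefixSmall⇔smallSize : (deg G ∘ to) Preserves Fin._≤_ ⟶ _≤_ →
    ∀ s → PrefixSmall s ⇔ SmallSize G k s
  prefixSmall⇔smallSize sorted s = mk⇔
    (λ P@(_ , s≤n , _) → prefix σ s , ∣prefix∣ σ s≤n , prefixSmall⇒isSmall P)
    (λ { (W , refl , ne , D) → nonempty⇒1≤∣p∣ ne , ∣p∣≤n W , ≤-trans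
           (sumOver-prefix-minimal σ (λ v → deg G v ^ k) (λ i≤j → ^-monoˡ-≤ k (sorted i≤j)) W)
           (subst (λ c → powSum G k W ≤ c * (n ∸ ∣ W ∣) ^ k) (sym (∣prefix∣ σ (∣p∣≤n W))) D) })

-- The hypothesis 1 ≤ k is only needed in Defs, to turn D_k(W) ≤ m into the power-sum form DkLe.
proposition5p3 : (n : ℕ) → 1 ≤ n → (G : Graph n) → (σ : Fin n ↔ Fin n) →
    (∀ (i j : Fin n) → toℕ i ≤ toℕ j → deg G (Inverse.to σ i) ≤ deg G (Inverse.to σ j)) →
    (k : ℕ) → 1 ≤ k →
    ∃ λ α → IsMax (SmallSize G k) α
      × IsMax (λ s → 1 ≤ s × s ≤ n × DkLe G k (prefix σ s) (n ∸ s)) α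
      × IsMax (λ s → 1 ≤ s × s ≤ n × IsSmall G k (prefix σ s)) α
proposition5p3 n 1≤n G σ sorted k _ =
  let α , isMax = prefixSmall-greatest G σ k 1≤n
  in  α , IsMax-cong (prefixSmall⇔smallSize G σ k (λ {i} {j} → sorted i j)) isMax
        , isMax
        , IsMax-cong (prefixSmall⇔isSmall G σ k) isMax
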